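{- For every positive integer $n$, $\frac n2-1\le d(n,l_\infty)\le n$.
   Context: A finite metric space $X=([n],\delta)$ is considered here only when all pairwise distances are distinct. For a norm $\|\cdot\|$ on $\mathbb{R}^t$, a map $\phi:X\to(\mathbb{R}^t,\|\cdot\|)$ is a monotone map if for all $w,x,y,z\in X$: $\delta(x,y)<\delta(w,z)\iff\|\phi(x)-\phi(y)\|<\|\phi(w)-\phi(z)\|$. $d(X,l_\infty)$ is the minimal $t$ such that there is a monotone map from $X$ into $(\mathbb{R}^t,\|\cdot\|_\infty)$, and $d(n,l_\infty)=\max_X d(X,l_\infty)$ over all $n$-point metric spaces $X$ with distinct distances.
   Formalization: The distances of each metric space X and the coordinates of points in the target space $(\mathbb{R}^t,\|\cdot\|_\infty)$ are taken in ℚ rather than ℝ. -}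

module Defs where

open import Data.Nat using (ℕ; zero; suc)
open import Data.Fin using (Fin; zero; suc)
open import Data.Rational using (ℚ; 0ℚ; _-_; _⊔_; ∣_∣; _<_; _≤_)
open import Data.Product using (Σ; _×_)
open import Data.Sum using (_⊎_)
open import Relation.Binary.PropositionalEquality using (_≡_; _≢_)
open import Function.Bundles using (_⇔_)

record DistinctMetric (n : ℕ) : Set where
  field
    δ        : Fin n → Fin n → ℚ
    δ-zero   : ∀ x → δ x x ≡ 0ℚ
    δ-pos    : ∀ x y → x ≢ y → 0ℚ < δ x y
    δ-sym    : ∀ x y → δ x y ≡ δ y x
    δ-tri    : ∀ x y z → δ x z ≤ Data.Rational._+_ (δ x y) (δ y z)
    δ-distinct : ∀ w x y z → x ≢ y → w ≢ z → δ x y ≡ δ w z →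
                 (x ≡ w × y ≡ z) ⊎ (x ≡ z × y ≡ w)

Pt : ℕ → Set
Pt t = Fin t → ℚ

‖_‖∞ : ∀ {t} → Pt t → ℚ
‖_‖∞ {zero}  v = 0ℚ
‖_‖∞ {suc t} v = ∣ v zero ∣ ⊔ ‖ (λ i → v (suc i)) ‖∞

dist∞ : ∀ {t} → Pt t → Pt t → ℚ
dist∞ u v = ‖ (λ i → u i - v i) ‖∞

Monotone : ∀ {n} (X : DistinctMetric n) (t : ℕ) → (Fin n → Pt t) → Set
Monotone X t φ = ∀ w x y z →
  (δ x y < δ w z) ⇔ (dist∞ (φ x) (φ y) < dist∞ (φ w) (φ z))
  where open DistinctMetric X

MonoEmbeds : ∀ {n} (X : DistinctMetric n) (t : ℕ) → Set
MonoEmbeds {n} X t = Σ (Fin n → Pt t) (Monotone X t)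

{-# OPTIONS --safe #-}
module Submission where

-- Upper bound: x ↦ (δ x i)ᵢ embeds X isometrically into ℓ∞ⁿ, hence monotonically.
-- Lower bound: split [n] into blocks {2i, 2i+1} and choose distinct distances in
-- (K, 2K], which always form a metric, so that the ⌊n/2⌋ block pairs are the farthest
-- pairs. A monotone image in ℓ∞ᵗ keeps each block pair farther apart than any two
-- points of different blocks. Assign to each block a coordinate where its
-- sup-distance is attained: two blocks sharing a coordinate would be two pairs of
-- rationals, each wider than every distance between them, which is impossible on a
-- line. Hence ⌊n/2⌋ ≤ t.

open import Defs
open import Data.Nat using (ℕ; _≤_; _*_; _+_)
open import Data.Product using (Σ; _×_)

open import Data.Bool using (Bool; true; false)
open import Data.Empty using (⊥; ⊥-elim)
open import Data.Fin as Fin using (Fin; zero; suc; toℕ; fromℕ<; combine)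
import Data.Fin.Properties as Fin
open import Data.Fin.Patterns using (0F; 1F)
open import Data.Integer as ℤ using (+_)
import Data.Integer.Properties as ℤ
open import Data.Nat as ℕ using (zero; suc; z≤n; s≤s; _<_; ⌊_/2⌋)
import Data.Nat.Properties as ℕ
open import Data.Product using (_,_; proj₁; proj₂; swap; uncurry)
open import Data.Rational as ℚ using (ℚ; 0ℚ; ∣_∣)
import Data.Rational.Properties as ℚ
open import Data.Rational.Literals using (fromℤ)
open import Data.Rational.Solver using (module +-*-Solver)
import Data.Rational.Unnormalised.Base as ℚᵘ
import Data.Rational.Unnormalised.Properties as ℚᵘ
open import Data.Sum as Sum using (_⊎_; inj₁; inj₂)
open import Function using (id; _∘_)
open import Function.Bundles using (Equivalence; mk⇔)
open import Relation.Binary.PropositionalEquality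
open import Relation.Nullary using (Dec; yes; no)

ι : ℕ → ℚ
ι k = fromℤ (+ k)

ι-+ : ∀ a b → ι (a + b) ≡ ι a ℚ.+ ι b
ι-+ a b = ℚ.toℚᵘ-injective
  (ℚᵘ.≃-trans (ℚᵘ.*≡* numerators) (ℚᵘ.≃-sym (ℚ.toℚᵘ-homo-+ (ι a) (ι b))))
  where
  numerators : + (a + b) ℤ.* + 1 ≡ (+ a ℤ.* + 1 ℤ.+ + b ℤ.* + 1) ℤ.* + 1
  numerators = cong (ℤ._* + 1) (trans (ℤ.pos-+ a b)
    (sym (cong₂ ℤ._+_ (ℤ.*-identityʳ (+ a)) (ℤ.*-identityʳ (+ b)))))

ι-mono-≤ : ∀ {a b} → a ≤ b → ι a ℚ.≤ ι b
ι-mono-≤ {a} {b} a≤b = ℚ.*≤* (subst₂ ℤ._≤_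
  (sym (ℤ.*-identityʳ (+ a))) (sym (ℤ.*-identityʳ (+ b))) (ℤ.+≤+ a≤b))

ι-mono-< : ∀ {a b} → a < b → ι a ℚ.< ι b
ι-mono-< {a} {b} a<b = ℚ.*<* (subst₂ ℤ._<_
  (sym (ℤ.*-identityʳ (+ a))) (sym (ℤ.*-identityʳ (+ b))) (ℤ.+<+ a<b))

ι-injective : ∀ {a b} → ι a ≡ ι b → a ≡ b
ι-injective = ℤ.+-injective ∘ cong ℚ.↥_

neg-sub : ∀ p q → ℚ.- (p ℚ.- q) ≡ q ℚ.- p
neg-sub = solve 2 (λ p q → :- (p :- q) := q :- p) refl
  where open +-*-Solver

p+q-q≡p : ∀ p q → (p ℚ.+ q) ℚ.- q ≡ p
p+q-q≡p = solve 2 (λ p q → (p :+ q) :- q := p) refl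
  where open +-*-Solver

p≤∣p∣ : ∀ p → p ℚ.≤ ∣ p ∣
p≤∣p∣ p with ℚ.≤-total 0ℚ p
... | inj₁ 0≤p = ℚ.≤-reflexive (sym (ℚ.0≤p⇒∣p∣≡p 0≤p))
... | inj₂ p≤0 = ℚ.≤-trans p≤0 (ℚ.0≤∣p∣ p)

∣p-q∣≡∣q-p∣ : ∀ p q → ∣ p ℚ.- q ∣ ≡ ∣ q ℚ.- p ∣
∣p-q∣≡∣q-p∣ p q = trans (cong ∣_∣ (sym (neg-sub q p))) (ℚ.∣-p∣≡∣p∣ (q ℚ.- p))

∣p-q∣≤r : ∀ {p q r} → p ℚ.≤ r ℚ.+ q → q ℚ.≤ r ℚ.+ p → ∣ p ℚ.- q ∣ ℚ.≤ r
∣p-q∣≤r {p} {q} {r} p≤r+q q≤r+p with ℚ.∣p∣≡p∨∣p∣≡-p (p ℚ.- q)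
... | inj₁ ∣p-q∣≡p-q = begin
  ∣ p ℚ.- q ∣        ≡⟨ ∣p-q∣≡p-q ⟩
  p ℚ.- q            ≤⟨ ℚ.+-monoˡ-≤ (ℚ.- q) p≤r+q ⟩
  r ℚ.+ q ℚ.- q      ≡⟨ p+q-q≡p r q ⟩
  r                  ∎
  where open ℚ.≤-Reasoning
... | inj₂ ∣p-q∣≡-[p-q] = begin
  ∣ p ℚ.- q ∣        ≡⟨ trans ∣p-q∣≡-[p-q] (neg-sub p q) ⟩
  q ℚ.- p            ≤⟨ ℚ.+-monoˡ-≤ (ℚ.- p) q≤r+p ⟩
  r ℚ.+ p ℚ.- p      ≡⟨ p+q-q≡p r p ⟩
  r                  ∎
  where open ℚ.≤-Reasoning

-- Distances in (K, 2K] satisfy every triangle inequality.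
module OffDiagonalMetric {n : ℕ} (K : ℕ) (w : Fin n → Fin n → ℕ)
  (K<w : ∀ x y → K < w x y) (w≤K+K : ∀ x y → w x y ≤ K + K)
  (w-comm : ∀ x y → w x y ≡ w y x)
  (w-injective : ∀ x y u v → w x y ≡ w u v → (x ≡ u × y ≡ v) ⊎ (x ≡ v × y ≡ u)) where

  δ : Fin n → Fin n → ℚ
  δ x y with x Fin.≟ y
  ... | yes _ = 0ℚ
  ... | no  _ = ι (w x y)

  δ-≢ : ∀ {x y} → x ≢ y → δ x y ≡ ι (w x y)
  δ-≢ {x} {y} x≢y with x Fin.≟ y
  ... | yes x≡y = ⊥-elim (x≢y x≡y)
  ... | no  _   = refl

  δ-refl : ∀ x → δ x x ≡ 0ℚ
  δ-refl x with x Fin.≟ x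
  ... | yes _   = refl
  ... | no  x≢x = ⊥-elim (x≢x refl)

  δ-nonneg : ∀ x y → 0ℚ ℚ.≤ δ x y
  δ-nonneg x y with x Fin.≟ y
  ... | yes _ = ℚ.≤-refl
  ... | no  _ = ι-mono-≤ z≤n

  δ-pos : ∀ x y → x ≢ y → 0ℚ ℚ.< δ x y
  δ-pos x y x≢y = subst (0ℚ ℚ.<_) (sym (δ-≢ x≢y)) (ι-mono-< (ℕ.≤-trans (s≤s z≤n) (K<w x y)))

  δ-sym : ∀ x y → δ x y ≡ δ y x
  δ-sym x y with x Fin.≟ y
  ... | yes refl = sym (δ-refl x)
  ... | no  x≢y  = trans (cong ι (w-comm x y)) (sym (δ-≢ (x≢y ∘ sym)))

  δ-tri : ∀ x y z → δ x z ℚ.≤ δ x y ℚ.+ δ y z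
  δ-tri x y z = by-cases (x Fin.≟ z) (x Fin.≟ y) (y Fin.≟ z)
    where
    by-cases : Dec (x ≡ z) → Dec (x ≡ y) → Dec (y ≡ z) → δ x z ℚ.≤ δ x y ℚ.+ δ y z
    by-cases (yes refl) _ _ = subst (ℚ._≤ δ x y ℚ.+ δ y x) (sym (δ-refl x))
                                (ℚ.+-mono-≤ (δ-nonneg x y) (δ-nonneg y x))
    by-cases _ (yes refl) _ = subst (λ d → δ x z ℚ.≤ d ℚ.+ δ x z) (sym (δ-refl x))
                                (ℚ.≤-reflexive (sym (ℚ.+-identityˡ (δ x z))))
    by-cases _ _ (yes refl) = subst (λ d → δ x y ℚ.≤ δ x y ℚ.+ d) (sym (δ-refl y))
                                (ℚ.≤-reflexive (sym (ℚ.+-identityʳ (δ x y))))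
    by-cases (no x≢z) (no x≢y) (no y≢z) = begin
      δ x z                   ≡⟨ δ-≢ x≢z ⟩
      ι (w x z)               ≤⟨ ι-mono-≤ (w≤K+K x z) ⟩
      ι (K + K)               ≡⟨ ι-+ K K ⟩
      ι K ℚ.+ ι K             ≤⟨ ℚ.+-mono-≤ (ι-mono-≤ (ℕ.<⇒≤ (K<w x y)))
                                             (ι-mono-≤ (ℕ.<⇒≤ (K<w y z))) ⟩
      ι (w x y) ℚ.+ ι (w y z) ≡⟨ sym (cong₂ ℚ._+_ (δ-≢ x≢y) (δ-≢ y≢z)) ⟩
      δ x y ℚ.+ δ y z         ∎
      where open ℚ.≤-Reasoning

  δ-distinct : ∀ u x y v → x ≢ y → u ≢ v → δ x y ≡ δ u v → (x ≡ u × y ≡ v) ⊎ (x ≡ v × y ≡ u)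
  δ-distinct u x y v x≢y u≢v δxy≡δuv =
    w-injective x y u v (ι-injective (trans (sym (δ-≢ x≢y)) (trans δxy≡δuv (δ-≢ u≢v))))

  metric : DistinctMetric n
  metric = record
    { δ = δ ; δ-zero = δ-refl ; δ-pos = δ-pos ; δ-sym = δ-sym ; δ-tri = δ-tri
    ; δ-distinct = δ-distinct }

‖‖∞-nonneg : ∀ {t} (v : Pt t) → 0ℚ ℚ.≤ ‖ v ‖∞
‖‖∞-nonneg {zero}  v = ℚ.≤-refl
‖‖∞-nonneg {suc t} v = ℚ.≤-trans (ℚ.0≤∣p∣ (v zero)) (ℚ.p≤p⊔q _ _)

∣v-k∣≤‖v‖∞ : ∀ {t} (v : Pt t) k → ∣ v k ∣ ℚ.≤ ‖ v ‖∞
∣v-k∣≤‖v‖∞ {suc t} v zero    = ℚ.p≤p⊔q _ _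
∣v-k∣≤‖v‖∞ {suc t} v (suc k) =
  ℚ.≤-trans (∣v-k∣≤‖v‖∞ (v ∘ suc) k) (ℚ.p≤q⊔p ∣ v zero ∣ _)

‖‖∞-lub : ∀ {t} (v : Pt t) {c} → 0ℚ ℚ.≤ c → (∀ k → ∣ v k ∣ ℚ.≤ c) → ‖ v ‖∞ ℚ.≤ c
‖‖∞-lub {zero}  v 0≤c _   = 0≤c
‖‖∞-lub {suc t} v 0≤c ∣v∣≤c = ℚ.⊔-lub (∣v∣≤c zero) (‖‖∞-lub (v ∘ suc) 0≤c (∣v∣≤c ∘ suc))

‖‖∞-attained : ∀ {t} (v : Pt t) → 0ℚ ℚ.< ‖ v ‖∞ → Σ (Fin t) λ k → ‖ v ‖∞ ≡ ∣ v k ∣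
‖‖∞-attained {zero}  v 0<0 = ⊥-elim (ℚ.<-irrefl refl 0<0)
‖‖∞-attained {suc t} v 0<‖v‖ with ℚ.⊔-sel ∣ v zero ∣ ‖ v ∘ suc ‖∞
... | inj₁ ‖v‖≡∣v₀∣   = zero , ‖v‖≡∣v₀∣
... | inj₂ ‖v‖≡‖tail‖ with ‖‖∞-attained (v ∘ suc) (subst (0ℚ ℚ.<_) ‖v‖≡‖tail‖ 0<‖v‖)
...   | k , ‖tail‖≡∣vₖ∣ = suc k , trans ‖v‖≡‖tail‖ ‖tail‖≡∣vₖ∣

below-both⇒far-from-one : ∀ {r p q} → r ℚ.≤ p → r ℚ.≤ q →
               ∣ p ℚ.- q ∣ ℚ.≤ ∣ r ℚ.- p ∣ ⊎ ∣ p ℚ.- q ∣ ℚ.≤ ∣ r ℚ.- q ∣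
below-both⇒far-from-one {r} {p} {q} r≤p r≤q with ℚ.∣p∣≡p∨∣p∣≡-p (p ℚ.- q)
... | inj₁ ∣p-q∣≡p-q = inj₁ (begin
  ∣ p ℚ.- q ∣  ≡⟨ ∣p-q∣≡p-q ⟩
  p ℚ.- q      ≤⟨ ℚ.+-monoʳ-≤ p (ℚ.neg-antimono-≤ r≤q) ⟩
  p ℚ.- r      ≤⟨ p≤∣p∣ (p ℚ.- r) ⟩
  ∣ p ℚ.- r ∣  ≡⟨ ∣p-q∣≡∣q-p∣ p r ⟩
  ∣ r ℚ.- p ∣  ∎)
  where open ℚ.≤-Reasoning
... | inj₂ ∣p-q∣≡-[p-q] = inj₂ (begin
  ∣ p ℚ.- q ∣  ≡⟨ trans ∣p-q∣≡-[p-q] (neg-sub p q) ⟩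
  q ℚ.- p      ≤⟨ ℚ.+-monoʳ-≤ q (ℚ.neg-antimono-≤ r≤p) ⟩
  q ℚ.- r      ≤⟨ p≤∣p∣ (q ℚ.- r) ⟩
  ∣ q ℚ.- r ∣  ≡⟨ ∣p-q∣≡∣q-p∣ q r ⟩
  ∣ r ℚ.- q ∣  ∎)
  where open ℚ.≤-Reasoning

below-both⇒¬near-both : ∀ {r p q} → r ℚ.≤ p → r ℚ.≤ q →
  ∣ r ℚ.- p ∣ ℚ.< ∣ p ℚ.- q ∣ → ∣ r ℚ.- q ∣ ℚ.< ∣ p ℚ.- q ∣ → ⊥
below-both⇒¬near-both r≤p r≤q near-p near-q with below-both⇒far-from-one r≤p r≤q
... | inj₁ far-p = ℚ.<-irrefl refl (ℚ.<-≤-trans near-p far-p)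
... | inj₂ far-q = ℚ.<-irrefl refl (ℚ.<-≤-trans near-q far-q)

argmin₂ : (f : Bool → ℚ) → Σ Bool λ β → ∀ γ → f β ℚ.≤ f γ
argmin₂ f with f false ℚ.≤? f true
... | yes f₀≤f₁ = false , λ { false → ℚ.≤-refl ; true → f₀≤f₁ }
... | no  f₀≰f₁ = true  , λ { false → ℚ.<⇒≤ (ℚ.≰⇒> f₀≰f₁) ; true → ℚ.≤-refl }

-- On a line, the lowest of four points is too close to both points of the other pair.
no-two-wide-pairs-in-ℚ : (a b : Bool → ℚ) →
  (∀ β γ → ∣ a β ℚ.- b γ ∣ ℚ.< ∣ b false ℚ.- b true ∣) →
  (∀ γ β → ∣ b γ ℚ.- a β ∣ ℚ.< ∣ a false ℚ.- a true ∣) → ⊥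
no-two-wide-pairs-in-ℚ a b a-near-b b-near-a with argmin₂ a | argmin₂ b
... | β , aβ≤a | γ , bγ≤b with a β ℚ.≤? b γ
...   | yes aβ≤bγ = below-both⇒¬near-both
          (ℚ.≤-trans aβ≤bγ (bγ≤b false)) (ℚ.≤-trans aβ≤bγ (bγ≤b true))
          (a-near-b β false) (a-near-b β true)
...   | no  aβ≰bγ = below-both⇒¬near-both
          (ℚ.≤-trans bγ≤aβ (aβ≤a false)) (ℚ.≤-trans bγ≤aβ (aβ≤a true))
          (b-near-a γ false) (b-near-a γ true)
  where
  bγ≤aβ = ℚ.<⇒≤ (ℚ.≰⇒> aβ≰bγ)

record WidePairs {A : Set} (d : A → A → ℚ) {m : ℕ} (p : Fin m → Bool → A) : Set where
  field
    spread-pos   : ∀ i → 0ℚ ℚ.< d (p i false) (p i true)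
    cross<spread : ∀ {i j} → i ≢ j → ∀ β γ → d (p i β) (p j γ) ℚ.< d (p j false) (p j true)

widePairs⇒≤dim : ∀ {m t} (P : Fin m → Bool → Pt t) → WidePairs dist∞ P → m ≤ t
widePairs⇒≤dim {m} {t} P wide = Fin.injective⇒≤ widest-injective
  where
  open WidePairs wide

  spread : Fin m → Pt t
  spread i k = P i false k ℚ.- P i true k

  widest : Fin m → Fin t
  widest i = proj₁ (‖‖∞-attained (spread i) (spread-pos i))

  cross<spread-at-widest : ∀ {i j} → i ≢ j → ∀ β γ →
    ∣ P i β (widest j) ℚ.- P j γ (widest j) ∣ ℚ.< ∣ spread j (widest j) ∣
  cross<spread-at-widest {i} {j} i≢j β γ = begin-strict
    ∣ P i β (widest j) ℚ.- P j γ (widest j) ∣  ≤⟨ ∣v-k∣≤‖v‖∞ _ (widest j) ⟩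
    dist∞ (P i β) (P j γ)                       <⟨ cross<spread i≢j β γ ⟩
    dist∞ (P j false) (P j true)                ≡⟨ proj₂ (‖‖∞-attained (spread j) (spread-pos j)) ⟩
    ∣ spread j (widest j) ∣                     ∎
    where open ℚ.≤-Reasoning

  widest-injective : ∀ {i j} → widest i ≡ widest j → i ≡ j
  widest-injective {i} {j} widest-i≡widest-j with i Fin.≟ j
  ... | yes i≡j = i≡j
  ... | no  i≢j = ⊥-elim (no-two-wide-pairs-in-ℚ
          (λ β → P i β (widest i)) (λ γ → P j γ (widest i)) i-near-j j-near-i)
    where
    i-near-j = subst (λ k → ∀ β γ → ∣ P i β k ℚ.- P j γ k ∣ ℚ.< ∣ spread j k ∣)
                     (sym widest-i≡widest-j) (cross<spread-at-widest i≢j)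
    j-near-i = cross<spread-at-widest (i≢j ∘ sym)

module _ {n : ℕ} (X : DistinctMetric n) where
  open DistinctMetric X

  δ-nonneg : ∀ x y → 0ℚ ℚ.≤ δ x y
  δ-nonneg x y with x Fin.≟ y
  ... | yes refl = ℚ.≤-reflexive (sym (δ-zero x))
  ... | no  x≢y  = ℚ.<⇒≤ (δ-pos x y x≢y)

  monotone-preserves-widePairs : ∀ {t m} (φ : Fin n → Pt t) → Monotone X t φ →
    {p : Fin m → Bool → Fin n} → WidePairs δ p → WidePairs dist∞ (λ i β → φ (p i β))
  monotone-preserves-widePairs {t} φ φ-mono {p} wide = record
    { spread-pos   = λ i → ℚ.≤-<-trans (‖‖∞-nonneg {t} _) (Equivalence.to
        (φ-mono (p i false) (p i false) (p i false) (p i true))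
        (subst (ℚ._< δ (p i false) (p i true)) (sym (δ-zero _)) (spread-pos i)))
    ; cross<spread = λ {i} {j} i≢j β γ → Equivalence.to
        (φ-mono (p j false) (p i β) (p j γ) (p j true)) (cross<spread i≢j β γ)
    }
    where open WidePairs wide

  monotone⇒widePairs≤dim : ∀ {t m} (φ : Fin n → Pt t) → Monotone X t φ →
    {p : Fin m → Bool → Fin n} → WidePairs δ p → m ≤ t
  monotone⇒widePairs≤dim φ φ-mono wide =
    widePairs⇒≤dim _ (monotone-preserves-widePairs φ φ-mono wide)

  isometry⇒monotone : ∀ {t} (φ : Fin n → Pt t) →
    (∀ x y → dist∞ (φ x) (φ y) ≡ δ x y) → Monotone X t φ
  isometry⇒monotone φ isometry w x y z rewrite isometry x y | isometry w z = mk⇔ id id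

  frechet : Fin n → Pt n
  frechet = δ

  frechet-isometry : ∀ x y → dist∞ (frechet x) (frechet y) ≡ δ x y
  frechet-isometry x y = ℚ.≤-antisym
    (‖‖∞-lub _ (δ-nonneg x y) reverse-triangle)
    (begin
      δ x y                      ≡⟨ sym (ℚ.0≤p⇒∣p∣≡p (δ-nonneg x y)) ⟩
      ∣ δ x y ∣                  ≡⟨ cong ∣_∣ (sym (ℚ.+-identityʳ (δ x y))) ⟩
      ∣ δ x y ℚ.- 0ℚ ∣           ≡⟨ cong (λ q → ∣ δ x y ℚ.- q ∣) (sym (δ-zero y)) ⟩
      ∣ δ x y ℚ.- δ y y ∣        ≤⟨ ∣v-k∣≤‖v‖∞ _ y ⟩
      dist∞ (frechet x) (frechet y) ∎)
    where
    open ℚ.≤-Reasoning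
    reverse-triangle : ∀ i → ∣ δ x i ℚ.- δ y i ∣ ℚ.≤ δ x y
    reverse-triangle i = ∣p-q∣≤r (δ-tri x y i)
      (subst (λ d → δ y i ℚ.≤ d ℚ.+ δ x i) (δ-sym y x) (δ-tri y x i))

⌊1+n+n/2⌋≡n : ∀ n → ⌊ suc (n + n) /2⌋ ≡ n
⌊1+n+n/2⌋≡n zero    = refl
⌊1+n+n/2⌋≡n (suc n) = cong suc (trans (cong ⌊_/2⌋ (ℕ.+-suc n n)) (⌊1+n+n/2⌋≡n n))

1+i+i<n : ∀ {i n} → i < ⌊ n /2⌋ → suc (i + i) < n
1+i+i<n {zero}  {suc (suc n)} _ = s≤s (s≤s z≤n)
1+i+i<n {suc i} {suc (suc n)} (s≤s i<⌊n/2⌋) =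
  s≤s (s≤s (subst (_< n) (sym (ℕ.+-suc i i)) (1+i+i<n i<⌊n/2⌋)))

n≤2[⌊n/2⌋+1] : ∀ n → n ≤ 2 * (⌊ n /2⌋ + 1)
n≤2[⌊n/2⌋+1] zero          = z≤n
n≤2[⌊n/2⌋+1] (suc zero)    = s≤s z≤n
n≤2[⌊n/2⌋+1] (suc (suc n)) =
  ℕ.≤-trans (s≤s (s≤s (n≤2[⌊n/2⌋+1] n))) (ℕ.≤-reflexive (sym (ℕ.*-suc 2 (⌊ n /2⌋ + 1))))

pairIndex : ℕ → Bool → ℕ
pairIndex i false = i + i
pairIndex i true  = suc (i + i)

⌊pairIndex/2⌋ : ∀ i β → ⌊ pairIndex i β /2⌋ ≡ i
⌊pairIndex/2⌋ i false = sym (ℕ.n≡⌊n+n/2⌋ i)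
⌊pairIndex/2⌋ i true  = ⌊1+n+n/2⌋≡n i

pairIndex<n : ∀ {i n} β → i < ⌊ n /2⌋ → pairIndex i β < n
pairIndex<n false i<⌊n/2⌋ = ℕ.<-trans (ℕ.n<1+n _) (1+i+i<n i<⌊n/2⌋)
pairIndex<n true  i<⌊n/2⌋ = 1+i+i<n i<⌊n/2⌋

minmax : ∀ {n} → Fin n → Fin n → Fin n × Fin n
minmax x y with x Fin.≤? y
... | yes _ = x , y
... | no  _ = y , x

minmax-comm : ∀ {n} (x y : Fin n) → minmax x y ≡ minmax y x
minmax-comm x y with x Fin.≤? y | y Fin.≤? x
... | yes x≤y | yes y≤x = cong₂ _,_ (Fin.≤-antisym x≤y y≤x) (Fin.≤-antisym y≤x x≤y)
... | yes _   | no  _   = refl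
... | no  _   | yes _   = refl
... | no  x≰y | no  y≰x = ⊥-elim (Sum.[ x≰y , y≰x ] (Fin.≤-total x y))

pairCode : ∀ {n} → Fin n → Fin n → Fin (n * n)
pairCode x y = uncurry combine (minmax x y)

pairCode-comm : ∀ {n} (x y : Fin n) → pairCode x y ≡ pairCode y x
pairCode-comm x y = cong (uncurry combine) (minmax-comm x y)

pairCode-injective : ∀ {n} (x y u v : Fin n) → pairCode x y ≡ pairCode u v →
                     (x ≡ u × y ≡ v) ⊎ (x ≡ v × y ≡ u)
pairCode-injective x y u v eq with x Fin.≤? y | u Fin.≤? v
... | yes _ | yes _ = inj₁ (Fin.combine-injective x y u v eq)
... | yes _ | no  _ = inj₂ (Fin.combine-injective x y v u eq)
... | no  _ | yes _ = inj₂ (swap (Fin.combine-injective y x u v eq))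
... | no  _ | no  _ = inj₁ (swap (Fin.combine-injective y x v u eq))

-- sameBlock is the leading digit of code, so pairs inside a block get the largest distances.
module BlockMetric (n : ℕ) where

  block : Fin n → ℕ
  block x = ⌊ toℕ x /2⌋

  sameBlock : Fin n → Fin n → Fin 2
  sameBlock x y with block x ℕ.≟ block y
  ... | yes _ = 1F
  ... | no  _ = 0F

  sameBlock-comm : ∀ x y → sameBlock x y ≡ sameBlock y x
  sameBlock-comm x y with block x ℕ.≟ block y | block y ℕ.≟ block x
  ... | yes _ | yes _ = refl
  ... | no  _ | no  _ = refl
  ... | yes bx≡by | no by≢bx = ⊥-elim (by≢bx (sym bx≡by))
  ... | no bx≢by | yes by≡bx = ⊥-elim (bx≢by (sym by≡bx))

  sameBlock-≢ : ∀ {x y} → block x ≢ block y → sameBlock x y ≡ 0F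
  sameBlock-≢ {x} {y} bx≢by with block x ℕ.≟ block y
  ... | yes bx≡by = ⊥-elim (bx≢by bx≡by)
  ... | no  _     = refl

  sameBlock-≡ : ∀ {x y} → block x ≡ block y → sameBlock x y ≡ 1F
  sameBlock-≡ {x} {y} bx≡by with block x ℕ.≟ block y
  ... | yes _     = refl
  ... | no  bx≢by = ⊥-elim (bx≢by bx≡by)

  code : Fin n → Fin n → Fin (2 * (n * n))
  code x y = combine (sameBlock x y) (pairCode x y)

  K : ℕ
  K = 2 * (n * n)

  weight : Fin n → Fin n → ℕ
  weight x y = K + suc (toℕ (code x y))

  K<weight : ∀ x y → K < weight x y
  K<weight x y = ℕ.m<m+n K ℕ.z<s

  weight≤K+K : ∀ x y → weight x y ≤ K + K
  weight≤K+K x y = ℕ.+-monoʳ-≤ K (Fin.toℕ<n (code x y))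

  weight-comm : ∀ x y → weight x y ≡ weight y x
  weight-comm x y = cong (λ c → K + suc (toℕ c))
    (cong₂ combine (sameBlock-comm x y) (pairCode-comm x y))

  weight-injective : ∀ x y u v → weight x y ≡ weight u v →
                     (x ≡ u × y ≡ v) ⊎ (x ≡ v × y ≡ u)
  weight-injective x y u v eq = pairCode-injective x y u v
    (Fin.combine-injectiveʳ (sameBlock x y) (pairCode x y) (sameBlock u v) (pairCode u v) code-eq)
    where
    code-eq : code x y ≡ code u v
    code-eq = Fin.toℕ-injective (ℕ.suc-injective (ℕ.+-cancelˡ-≡ K _ _ eq))

  weight-across<weight-within : ∀ {x y u v} → block x ≢ block y → block u ≡ block v →
                                weight x y < weight u v
  weight-across<weight-within {x} {y} {u} {v} bx≢by bu≡bv
    rewrite sameBlock-≢ bx≢by | sameBlock-≡ bu≡bv =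
    ℕ.+-monoʳ-< K (s≤s (Fin.combine-monoˡ-< {m = 2} {i = 0F} {j = 1F}
      (pairCode x y) (pairCode u v) ℕ.z<s))

  module Weighted = OffDiagonalMetric K weight K<weight weight≤K+K weight-comm weight-injective
  open Weighted using (δ; δ-≢; δ-pos)

  metric : DistinctMetric n
  metric = Weighted.metric

  pairPoint : Fin ⌊ n /2⌋ → Bool → Fin n
  pairPoint i β = fromℕ< (pairIndex<n β (Fin.toℕ<n i))

  block-pairPoint : ∀ i β → block (pairPoint i β) ≡ toℕ i
  block-pairPoint i β = trans (cong ⌊_/2⌋ (Fin.toℕ-fromℕ< _)) (⌊pairIndex/2⌋ (toℕ i) β)

  pairPoint-distinct : ∀ i → pairPoint i false ≢ pairPoint i true
  pairPoint-distinct i eq = ℕ.1+n≢n (sym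
    (trans (sym (Fin.toℕ-fromℕ< _)) (trans (cong toℕ eq) (Fin.toℕ-fromℕ< _))))

  pairs-wide : WidePairs δ pairPoint
  pairs-wide = record
    { spread-pos   = λ i → δ-pos _ _ (pairPoint-distinct i)
    ; cross<spread = cross<spread
    }
    where
    cross<spread : ∀ {i j} → i ≢ j → ∀ β γ →
      δ (pairPoint i β) (pairPoint j γ) ℚ.< δ (pairPoint j false) (pairPoint j true)
    cross<spread {i} {j} i≢j β γ = begin-strict
      δ (pairPoint i β) (pairPoint j γ)
        ≡⟨ δ-≢ (blocks-differ ∘ cong block) ⟩
      ι (weight (pairPoint i β) (pairPoint j γ))
        <⟨ ι-mono-< (weight-across<weight-within blocks-differ same-block) ⟩
      ι (weight (pairPoint j false) (pairPoint j true))
        ≡⟨ sym (δ-≢ (pairPoint-distinct j)) ⟩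
      δ (pairPoint j false) (pairPoint j true)
        ∎
      where
      open ℚ.≤-Reasoning
      blocks-differ : block (pairPoint i β) ≢ block (pairPoint j γ)
      blocks-differ eq = i≢j (Fin.toℕ-injective
        (trans (sym (block-pairPoint i β)) (trans eq (block-pairPoint j γ))))
      same-block : block (pairPoint j false) ≡ block (pairPoint j true)
      same-block = trans (block-pairPoint j false) (sym (block-pairPoint j true))

lemma2 : (n : ℕ) → 1 ≤ n →
    Σ (DistinctMetric n) (λ X → (t : ℕ) → MonoEmbeds X t → n ≤ 2 * (t + 1))
    × ((X : DistinctMetric n) → Σ ℕ (λ t → t ≤ n × MonoEmbeds X t))
lemma2 n _ = (BlockMetric.metric n , lower-bound) , upper-bound
  where
  lower-bound : ∀ t → MonoEmbeds (BlockMetric.metric n) t → n ≤ 2 * (t + 1)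
  lower-bound t (φ , φ-mono) = begin
    n                  ≤⟨ n≤2[⌊n/2⌋+1] n ⟩
    2 * (⌊ n /2⌋ + 1)  ≤⟨ ℕ.*-monoʳ-≤ 2 (ℕ.+-monoˡ-≤ 1 ⌊n/2⌋≤t) ⟩
    2 * (t + 1)        ∎
    where
    open ℕ.≤-Reasoning
    ⌊n/2⌋≤t : ⌊ n /2⌋ ≤ t
    ⌊n/2⌋≤t = monotone⇒widePairs≤dim (BlockMetric.metric n) φ φ-mono (BlockMetric.pairs-wide n)

  upper-bound : (X : DistinctMetric n) → Σ ℕ (λ t → t ≤ n × MonoEmbeds X t)
  upper-bound X = n , ℕ.≤-refl , frechet X , isometry⇒monotone X (frechet X) (frechet-isometry X)
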